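{- Let $k\ge 2$, let $H_0$ be a finite $k$-uniform hypergraph and $H_t=\mathrm{ILTH}_t(H_0)$. Let $i\in\{13,14,15,24,25\}$. If $H_0$ contains a motif of type $i$ whose three hyperedges together contain $m$ vertices, then $H_t$ contains at least $(m+1)^t$ motifs of type $i$, for every $t\ge 0$.
   Context: ILTH model: given $H_t$, $H_{t+1}$ has vertex set $V(H_t)\cup\{x':x\in V(H_t)\}$ where each $x'$ is a new vertex (the clone of $x$), and hyperedge set $E(H_t)\cup\{(e\setminus\{x\})\cup\{x'\}: e\in E(H_t), x\in e\}$. A motif is a triple $(e_1,e_2,e_3)$ of distinct hyperedges. Consider the seven regions $e_1\setminus(e_2\cup e_3)$, $e_2\setminus(e_1\cup e_3)$, $e_3\setminus(e_1\cup e_2)$, $(e_1\cap e_2)\setminus e_3$, $(e_2\cap e_3)\setminus e_1$, $(e_1\cap e_3)\setminus e_2$, $e_1\cap e_2\cap e_3$, in this order; the motif's binary string $i_1\cdots i_7$ has $i_j=1$ iff the $j$-th region is nonempty. The motif has type 13, 14, 15, 24, 25 if, for some ordering of its three hyperedges, its binary string is respectively $0001111$, $1001111$, $1011111$, $1001110$, $1011110$. -}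

module Defs where

open import Data.Nat using (ℕ; zero; suc; _+_)
open import Data.Fin using (Fin; zero; suc)
open import Data.Fin.Subset using (Subset; _∈_; _∉_; _∩_; _∪_; ∁; ⁅_⁆; ∣_∣; Nonempty; Empty; ⊥)
open import Data.Vec using (Vec; []; _∷_; _++_; lookup; _[_]≔_)
open import Data.Bool using (Bool; true; false)
open import Data.Product using (Σ; ∃; _×_; _,_)
open import Data.Sum using (_⊎_)
open import Relation.Binary.PropositionalEquality using (_≡_; _≢_)
open import Relation.Nullary using (¬_)

-- A finite hypergraph: vertex set Fin n, hyperedge set given as a
-- predicate on subsets of Fin n (hence automatically finite).
record Hypergraph : Set₁ where
  field
    n    : ℕ
    Edge : Subset n → Set
open Hypergraph public

Uniform : ℕ → Hypergraph → Set
Uniform k H = ∀ (e : Subset (n H)) → Edge H e → ∣ e ∣ ≡ k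

-- Vertices of the new hypergraph are Fin (n + n):
-- the first n are the old vertices x (as  x ++ ...), the last n are the
-- clones x'.  A subset of Fin (n + n) is written  a ++ b  with a the old
-- part and b the clone part.
-- New edges:  (e \ {x}) ∪ {x'}  =  (e [ x ]≔ false) ++ ⁅ x ⁆  for e ∈ E, x ∈ e.
data ILTHEdge (H : Hypergraph) : Subset (n H + n H) → Set where
  old   : ∀ e → Edge H e → ILTHEdge H (e ++ ⊥)
  clone : ∀ e x → Edge H e → x ∈ e → ILTHEdge H ((e [ x ]≔ false) ++ ⁅ x ⁆)

ILTH : Hypergraph → Hypergraph
ILTH H = record { n = n H + n H ; Edge = ILTHEdge H }

ILTH^ : ℕ → Hypergraph → Hypergraph
ILTH^ zero    H = H
ILTH^ (suc t) H = ILTH (ILTH^ t H)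

Triple : ℕ → Set
Triple m = Subset m × Subset m × Subset m

data Perm3 : Set where
  p123 p132 p213 p231 p312 p321 : Perm3

reorder : ∀ {m} → Perm3 → Triple m → Triple m
reorder p123 (a , b , c) = a , b , c
reorder p132 (a , b , c) = a , c , b
reorder p213 (a , b , c) = b , a , c
reorder p231 (a , b , c) = b , c , a
reorder p312 (a , b , c) = c , a , b
reorder p321 (a , b , c) = c , b , a

IsMotif : (H : Hypergraph) → Triple (n H) → Set
IsMotif H (a , b , c) =
  Edge H a × Edge H b × Edge H c × a ≢ b × b ≢ c × a ≢ c

-- The seven regions, in the order of the paper.
regions : ∀ {m} → Triple m → Vec (Subset m) 7
regions (a , b , c) =
  (a ∩ ∁ (b ∪ c)) ∷ (b ∩ ∁ (a ∪ c)) ∷ (c ∩ ∁ (a ∪ b)) ∷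
  ((a ∩ b) ∩ ∁ c) ∷ ((b ∩ c) ∩ ∁ a) ∷ ((a ∩ c) ∩ ∁ b) ∷ (a ∩ b ∩ c) ∷ []

HasString : ∀ {m} → Vec Bool 7 → Triple m → Set
HasString s t = ∀ (j : Fin 7) →
  (lookup s j ≡ true → Nonempty (lookup (regions t) j)) ×
  (lookup s j ≡ false → Empty (lookup (regions t) j))

data MotifType : Set where
  type13 type14 type15 type24 type25 : MotifType

pattern-of : MotifType → Vec Bool 7
pattern-of type13 = false ∷ false ∷ false ∷ true ∷ true ∷ true ∷ true ∷ []
pattern-of type14 = true  ∷ false ∷ false ∷ true ∷ true ∷ true ∷ true ∷ []
pattern-of type15 = true  ∷ false ∷ true  ∷ true ∷ true ∷ true ∷ true ∷ []
pattern-of type24 = true  ∷ false ∷ false ∷ true ∷ true ∷ true ∷ false ∷ []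
pattern-of type25 = true  ∷ false ∷ true  ∷ true ∷ true ∷ true ∷ false ∷ []

HasType : ∀ {m} → MotifType → Triple m → Set
HasType i t = ∃ λ σ → HasString (pattern-of i) (reorder σ t)

MotifOfType : (H : Hypergraph) → MotifType → Triple (n H) → Set
MotifOfType H i t = IsMotif H t × HasType i t

SameMotif : ∀ {m} → Triple m → Triple m → Set
SameMotif t t' = ∃ λ σ → t' ≡ reorder σ t

AtLeastMotifs : ℕ → MotifType → Hypergraph → Set
AtLeastMotifs N i H =
  Σ (Fin N → Triple (n H)) λ f →
    (∀ j → MotifOfType H i (f j)) ×
    (∀ j j' → SameMotif (f j) (f j') → j ≡ j')

verticesOf : ∀ {m} → Triple m → ℕ
verticesOf (a , b , c) = ∣ a ∪ b ∪ c ∣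

-- Fix a motif T of H whose hyperedges cover m vertices. For every choice c
-- among "nothing" and those m vertices, replacing each hyperedge e of T by
-- its clone at c (the old edge e if c is nothing or c ∉ e) gives a motif of
-- ILTH H with the same binary string: the cloned vertex just takes over the
-- role of c, and every other new vertex lies in none of the three edges.
-- The m + 1 motifs so obtained are distinct, since the choice is read off
-- as the unique clone vertex they cover, and clones of distinct motifs are
-- distinct, since forgetting the clone/original distinction recovers T.
-- The copies of the m covered vertices stay covered, so the argument iterates.
module Submission where

open import Defs
open import Data.Nat using (ℕ; suc; _+_; _*_; _^_; _≤_)
open import Data.Nat.Properties using (+-comm)
open import Data.Fin using (Fin; zero; suc; _↑ˡ_; _↑ʳ_; splitAt; remQuot; combine; _≟_)
open import Data.Fin.Properties
  using (splitAt-↑ˡ; splitAt-↑ʳ; splitAt⁻¹-↑ˡ; splitAt⁻¹-↑ʳ; combine-remQuot; suc-injective)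
open import Data.Fin.Subset using (Subset; _∈_; _∩_; _∪_; ∁; ⁅_⁆; ∣_∣; Nonempty; ⊥)
open import Data.Fin.Subset.Properties using (∪-comm; ∪-assoc; x∈⁅x⁆)
open import Data.Vec using (Vec; _∷_; []; _++_; lookup; _[_]≔_)
open import Data.Vec.Properties
  using (lookup-++ˡ; lookup-++ʳ; lookup∘update; lookup∘update′; lookup-zipWith; lookup-map;
         lookup-replicate; []=⇒lookup; lookup⇒[]=; tabulate∘lookup; tabulate-cong)
open import Data.Bool using (Bool; true; false; _∧_; _∨_; not; if_then_else_)
open import Data.Bool.Properties using (∨-identityʳ)
open import Data.Maybe using (Maybe; just; nothing)
open import Data.Maybe.Properties using (just-injective; ≡-dec)
open import Data.Product using (Σ; ∃; _×_; _,_; proj₁; proj₂; uncurry)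
open import Data.Sum using (_⊎_; inj₁; inj₂; reduce)
open import Data.Empty using (⊥-elim)
open import Function using (_∘_)
open import Function.Definitions using (Injective)
open import Relation.Binary.PropositionalEquality
  using (_≡_; _≢_; refl; sym; trans; cong; cong₂; subst; module ≡-Reasoning)
open import Relation.Nullary using (yes; no)

private
  variable
    k m : ℕ

lookup-extensionality : ∀ {A : Set} (u v : Vec A k) → (∀ i → lookup u i ≡ lookup v i) → u ≡ v
lookup-extensionality u v u≗v =
  trans (sym (tabulate∘lookup u)) (trans (tabulate-cong u≗v) (tabulate∘lookup v))

false≢true : false ≢ true
false≢true ()

lookup-∩ : (p q : Subset k) (v : Fin k) → lookup (p ∩ q) v ≡ lookup p v ∧ lookup q v
lookup-∩ p q v = lookup-zipWith _∧_ v p q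

lookup-∪ : (p q : Subset k) (v : Fin k) → lookup (p ∪ q) v ≡ lookup p v ∨ lookup q v
lookup-∪ p q v = lookup-zipWith _∨_ v p q

lookup-∁ : (p : Subset k) (v : Fin k) → lookup (∁ p) v ≡ not (lookup p v)
lookup-∁ p v = lookup-map v not p

lookup-⊥ : (v : Fin k) → lookup (⊥ {k}) v ≡ false
lookup-⊥ v = lookup-replicate v false

lookup-⁅⁆-other : (x y : Fin k) → y ≢ x → lookup ⁅ x ⁆ y ≡ false
lookup-⁅⁆-other zero    zero    y≢x = ⊥-elim (y≢x refl)
lookup-⁅⁆-other zero    (suc y) _   = lookup-⊥ y
lookup-⁅⁆-other (suc x) zero    _   = refl
lookup-⁅⁆-other (suc x) (suc y) y≢x = lookup-⁅⁆-other x y (y≢x ∘ cong suc)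

∪-left-comm : (p q r : Subset k) → p ∪ (q ∪ r) ≡ q ∪ (p ∪ r)
∪-left-comm p q r =
  trans (sym (∪-assoc p q r)) (trans (cong (_∪ r) (∪-comm p q)) (∪-assoc q p r))

remQuot-injective : ∀ d {i j : Fin (m * d)} → remQuot {m} d i ≡ remQuot d j → i ≡ j
remQuot-injective {m} d {i} {j} eq =
  trans (sym (combine-remQuot {m} d i)) (trans (cong (uncurry combine) eq) (combine-remQuot {m} d j))

enumerate : (p : Subset k) →
  Σ (Fin ∣ p ∣ → Fin k) λ g → (∀ l → lookup p (g l) ≡ true) × Injective _≡_ _≡_ g
enumerate [] = (λ ()) , (λ ()) , λ {}
enumerate (false ∷ p) with enumerate p
... | g , g∈p , g-inj = suc ∘ g , g∈p , g-inj ∘ suc-injective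
enumerate (true ∷ p) with enumerate p
... | g , g∈p , g-inj = g′ , g′∈p , g′-inj
  where
  g′ : Fin (suc ∣ p ∣) → Fin _
  g′ zero    = zero
  g′ (suc l) = suc (g l)
  g′∈p : ∀ l → lookup (true ∷ p) (g′ l) ≡ true
  g′∈p zero    = refl
  g′∈p (suc l) = g∈p l
  g′-inj : Injective _≡_ _≡_ g′
  g′-inj {zero}  {zero}  _  = refl
  g′-inj {suc l} {suc l′} eq = cong suc (g-inj (suc-injective eq))

Profile : Set
Profile = Bool × Bool × Bool

outside : Profile
outside = false , false , false

profile : Triple k → Fin k → Profile
profile (a , b , c) v = lookup a v , lookup b v , lookup c v

anyOf : Profile → Bool
anyOf (p , q , r) = p ∨ q ∨ r

map3 : (Subset k → Subset m) → Triple k → Triple m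
map3 f (a , b , c) = f a , f b , f c

reorder-map3 : ∀ σ (f : Subset k → Subset m) T → reorder σ (map3 f T) ≡ map3 f (reorder σ T)
reorder-map3 p123 f (a , b , c) = refl
reorder-map3 p132 f (a , b , c) = refl
reorder-map3 p213 f (a , b , c) = refl
reorder-map3 p231 f (a , b , c) = refl
reorder-map3 p312 f (a , b , c) = refl
reorder-map3 p321 f (a , b , c) = refl

union : Triple k → Subset k
union (a , b , c) = a ∪ b ∪ c

lookup-union : ∀ (T : Triple k) v → lookup (union T) v ≡ anyOf (profile T v)
lookup-union (a , b , c) v = trans (lookup-∪ a (b ∪ c) v) (cong (lookup a v ∨_) (lookup-∪ b c v))

union-reorder : ∀ σ (T : Triple k) → union (reorder σ T) ≡ union T
union-reorder p123 (a , b , c) = refl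
union-reorder p132 (a , b , c) = cong (a ∪_) (∪-comm c b)
union-reorder p213 (a , b , c) = ∪-left-comm b a c
union-reorder p231 (a , b , c) = trans (cong (b ∪_) (∪-comm c a)) (∪-left-comm b a c)
union-reorder p312 (a , b , c) = trans (∪-left-comm c a b) (cong (a ∪_) (∪-comm c b))
union-reorder p321 (a , b , c) =
  trans (cong (c ∪_) (∪-comm b a)) (trans (∪-left-comm c a b) (cong (a ∪_) (∪-comm c b)))

SameMotif⇒union≡ : {T T′ : Triple k} → SameMotif T T′ → union T ≡ union T′
SameMotif⇒union≡ {T = T} (σ , refl) = sym (union-reorder σ T)

regionBit : Fin 7 → Profile → Bool
regionBit zero                                   (p , q , r) = p ∧ not (q ∨ r)
regionBit (suc zero)                             (p , q , r) = q ∧ not (p ∨ r)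
regionBit (suc (suc zero))                       (p , q , r) = r ∧ not (p ∨ q)
regionBit (suc (suc (suc zero)))                 (p , q , r) = (p ∧ q) ∧ not r
regionBit (suc (suc (suc (suc zero))))           (p , q , r) = (q ∧ r) ∧ not p
regionBit (suc (suc (suc (suc (suc zero)))))     (p , q , r) = (p ∧ r) ∧ not q
regionBit (suc (suc (suc (suc (suc (suc zero)))))) (p , q , r) = p ∧ (q ∧ r)

regionBit-outside : ∀ j → regionBit j outside ≡ false
regionBit-outside zero                                   = refl
regionBit-outside (suc zero)                             = refl
regionBit-outside (suc (suc zero))                       = refl
regionBit-outside (suc (suc (suc zero)))                 = refl
regionBit-outside (suc (suc (suc (suc zero))))           = refl
regionBit-outside (suc (suc (suc (suc (suc zero)))))     = refl
regionBit-outside (suc (suc (suc (suc (suc (suc zero)))))) = refl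

lookup-regions : ∀ j (T : Triple k) v → lookup (lookup (regions T) j) v ≡ regionBit j (profile T v)
lookup-regions zero (a , b , c) v
  rewrite lookup-∩ a (∁ (b ∪ c)) v | lookup-∁ (b ∪ c) v | lookup-∪ b c v = refl
lookup-regions (suc zero) (a , b , c) v
  rewrite lookup-∩ b (∁ (a ∪ c)) v | lookup-∁ (a ∪ c) v | lookup-∪ a c v = refl
lookup-regions (suc (suc zero)) (a , b , c) v
  rewrite lookup-∩ c (∁ (a ∪ b)) v | lookup-∁ (a ∪ b) v | lookup-∪ a b v = refl
lookup-regions (suc (suc (suc zero))) (a , b , c) v
  rewrite lookup-∩ (a ∩ b) (∁ c) v | lookup-∩ a b v | lookup-∁ c v = refl
lookup-regions (suc (suc (suc (suc zero)))) (a , b , c) v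
  rewrite lookup-∩ (b ∩ c) (∁ a) v | lookup-∩ b c v | lookup-∁ a v = refl
lookup-regions (suc (suc (suc (suc (suc zero))))) (a , b , c) v
  rewrite lookup-∩ (a ∩ c) (∁ b) v | lookup-∩ a c v | lookup-∁ b v = refl
lookup-regions (suc (suc (suc (suc (suc (suc zero)))))) (a , b , c) v
  rewrite lookup-∩ a (b ∩ c) v | lookup-∩ b c v = refl

-- The binary string only depends on which profiles other than outside occur.
HasString-transport : ∀ {k′} (T : Triple k) (T′ : Triple k′) →
  (∀ v → ∃ λ w → profile T′ w ≡ profile T v) →
  (∀ w → (∃ λ v → profile T′ w ≡ profile T v) ⊎ profile T′ w ≡ outside) →
  ∀ {s} → HasString s T → HasString s T′
HasString-transport T T′ onto into hs j =
  (λ sⱼ → forth (proj₁ (hs j) sⱼ)) , (λ sⱼ w∈ → proj₂ (hs j) sⱼ (back w∈))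
  where
  ∈-region : ∀ {k} (U : Triple k) {v} → v ∈ lookup (regions U) j →
    regionBit j (profile U v) ≡ true
  ∈-region U v∈ = trans (sym (lookup-regions j U _)) ([]=⇒lookup v∈)
  region-∈ : ∀ {k} (U : Triple k) {v} → regionBit j (profile U v) ≡ true →
    v ∈ lookup (regions U) j
  region-∈ U eq = lookup⇒[]= _ _ (trans (lookup-regions j U _) eq)
  forth : Nonempty (lookup (regions T) j) → Nonempty (lookup (regions T′) j)
  forth (v , v∈) with onto v
  ... | w , eq = w , region-∈ T′ (trans (cong (regionBit j) eq) (∈-region T v∈))
  back : Nonempty (lookup (regions T′) j) → Nonempty (lookup (regions T) j)
  back (w , w∈) with into w
  ... | inj₁ (v , eq) = v , region-∈ T (trans (cong (regionBit j) (sym eq)) (∈-region T′ w∈))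
  ... | inj₂ eq = ⊥-elim (false≢true (trans (sym (regionBit-outside j))
                    (trans (cong (regionBit j) (sym eq)) (∈-region T′ w∈))))

cloneAt : Maybe (Fin k) → Subset k → Subset (k + k)
cloneAt nothing  e = e ++ ⊥
cloneAt (just x) e = if lookup e x then (e [ x ]≔ false) ++ ⁅ x ⁆ else e ++ ⊥

cloneAt-edge : ∀ {H} c {e} → Edge H e → ILTHEdge H (cloneAt c e)
cloneAt-edge nothing  e∈E = old _ e∈E
cloneAt-edge (just x) {e} e∈E with lookup e x in x∈e
... | true  = clone e x e∈E (lookup⇒[]= x e x∈e)
... | false = old e e∈E

lookup-cloneAt-old : ∀ x (e : Subset k) v → v ≢ x → lookup (cloneAt (just x) e) (v ↑ˡ k) ≡ lookup e v
lookup-cloneAt-old x e v v≢x with lookup e x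
... | true  = trans (lookup-++ˡ (e [ x ]≔ false) ⁅ x ⁆ v) (lookup∘update′ v≢x e false)
... | false = lookup-++ˡ e ⊥ v

lookup-cloneAt-old-self : ∀ x (e : Subset k) → lookup (cloneAt (just x) e) (x ↑ˡ k) ≡ false
lookup-cloneAt-old-self x e with lookup e x in eq
... | true  = trans (lookup-++ˡ (e [ x ]≔ false) ⁅ x ⁆ x) (lookup∘update x e false)
... | false = trans (lookup-++ˡ e ⊥ x) eq

lookup-cloneAt-clone-self : ∀ x (e : Subset k) → lookup (cloneAt (just x) e) (k ↑ʳ x) ≡ lookup e x
lookup-cloneAt-clone-self x e with lookup e x
... | true  = trans (lookup-++ʳ (e [ x ]≔ false) ⁅ x ⁆ x) ([]=⇒lookup (x∈⁅x⁆ x))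
... | false = trans (lookup-++ʳ e ⊥ x) (lookup-⊥ x)

lookup-cloneAt-clone : ∀ c (e : Subset k) y → c ≢ just y → lookup (cloneAt c e) (k ↑ʳ y) ≡ false
lookup-cloneAt-clone nothing e y _ = trans (lookup-++ʳ e ⊥ y) (lookup-⊥ y)
lookup-cloneAt-clone (just x) e y c≢y with lookup e x
... | true  = trans (lookup-++ʳ (e [ x ]≔ false) ⁅ x ⁆ y) (lookup-⁅⁆-other x y (c≢y ∘ cong just ∘ sym))
... | false = trans (lookup-++ʳ e ⊥ y) (lookup-⊥ y)

-- Forgetting the difference between a vertex and its clone undoes cloneAt.
lookup-cloneAt-merge : ∀ c (e : Subset k) v →
  lookup (cloneAt c e) (v ↑ˡ k) ∨ lookup (cloneAt c e) (k ↑ʳ v) ≡ lookup e v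
lookup-cloneAt-merge nothing e v =
  trans (cong₂ _∨_ (lookup-++ˡ e ⊥ v) (lookup-cloneAt-clone nothing e v λ ())) (∨-identityʳ _)
lookup-cloneAt-merge (just x) e v with v ≟ x
... | yes refl = cong₂ _∨_ (lookup-cloneAt-old-self x e) (lookup-cloneAt-clone-self x e)
... | no v≢x   = trans (cong₂ _∨_ (lookup-cloneAt-old x e v v≢x)
                                  (lookup-cloneAt-clone (just x) e v (v≢x ∘ sym ∘ just-injective)))
                       (∨-identityʳ _)

cloneAt-injective : ∀ c c′ {e e′ : Subset k} → cloneAt c e ≡ cloneAt c′ e′ → e ≡ e′
cloneAt-injective {k} c c′ {e} {e′} eq = lookup-extensionality e e′ λ v →
  trans (sym (lookup-cloneAt-merge c e v))
    (trans (cong (λ s → lookup s (v ↑ˡ k) ∨ lookup s (k ↑ʳ v)) eq) (lookup-cloneAt-merge c′ e′ v))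

map3-cloneAt-injective : ∀ c c′ {T T′ : Triple k} → map3 (cloneAt c) T ≡ map3 (cloneAt c′) T′ → T ≡ T′
map3-cloneAt-injective c c′ {a , b , d} {a′ , b′ , d′} eq =
  cong₂ _,_ (cloneAt-injective c c′ (cong proj₁ eq))
    (cong₂ _,_ (cloneAt-injective c c′ (cong (proj₁ ∘ proj₂) eq))
               (cloneAt-injective c c′ (cong (proj₂ ∘ proj₂) eq)))

-- The vertex of ILTH H playing the role of v in the edges cloned at c.
embed : Maybe (Fin k) → Fin k → Fin (k + k)
embed {k} nothing  v = v ↑ˡ k
embed {k} (just x) v with v ≟ x
... | yes _ = k ↑ʳ v
... | no  _ = v ↑ˡ k

embed-self : ∀ (x : Fin k) → embed (just x) x ≡ k ↑ʳ x
embed-self x with x ≟ x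
... | yes _   = refl
... | no  x≢x = ⊥-elim (x≢x refl)

embed-other : ∀ (x v : Fin k) → v ≢ x → embed (just x) v ≡ v ↑ˡ k
embed-other x v v≢x with v ≟ x
... | yes v≡x = ⊥-elim (v≢x v≡x)
... | no  _   = refl

forget-embed : ∀ c (v : Fin k) → reduce (splitAt k (embed c v)) ≡ v
forget-embed {k} nothing  v = cong reduce (splitAt-↑ˡ k v k)
forget-embed {k} (just x) v with v ≟ x
... | yes _ = cong reduce (splitAt-↑ʳ k k v)
... | no  _ = cong reduce (splitAt-↑ˡ k v k)

embed-injective : ∀ (c : Maybe (Fin k)) → Injective _≡_ _≡_ (embed c)
embed-injective {k} c {v} {v′} eq =
  trans (sym (forget-embed c v)) (trans (cong (reduce ∘ splitAt k) eq) (forget-embed c v′))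

lookup-cloneAt-embed : ∀ c (e : Subset k) v → lookup (cloneAt c e) (embed c v) ≡ lookup e v
lookup-cloneAt-embed nothing  e v = lookup-++ˡ e ⊥ v
lookup-cloneAt-embed (just x) e v with v ≟ x
... | yes refl = lookup-cloneAt-clone-self x e
... | no  v≢x  = lookup-cloneAt-old x e v v≢x

embed-or-outside-old : ∀ c (v : Fin k) →
  (∃ λ u → v ↑ˡ k ≡ embed c u) ⊎ (∀ e → lookup (cloneAt c e) (v ↑ˡ k) ≡ false)
embed-or-outside-old nothing  v = inj₁ (v , refl)
embed-or-outside-old (just x) v with v ≟ x
... | yes refl = inj₂ (lookup-cloneAt-old-self x)
... | no  v≢x  = inj₁ (v , sym (embed-other x v v≢x))

embed-or-outside-clone : ∀ c (v : Fin k) →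
  (∃ λ u → k ↑ʳ v ≡ embed c u) ⊎ (∀ e → lookup (cloneAt c e) (k ↑ʳ v) ≡ false)
embed-or-outside-clone nothing  v = inj₂ λ e → lookup-cloneAt-clone nothing e v λ ()
embed-or-outside-clone (just x) v with v ≟ x
... | yes refl = inj₁ (v , sym (embed-self v))
... | no  v≢x  = inj₂ λ e → lookup-cloneAt-clone (just x) e v (v≢x ∘ sym ∘ just-injective)

embed-or-outside : ∀ c (w : Fin (k + k)) →
  (∃ λ v → w ≡ embed c v) ⊎ (∀ e → lookup (cloneAt c e) w ≡ false)
embed-or-outside {k} c w with splitAt k w in eq
... | inj₁ v with refl ← splitAt⁻¹-↑ˡ eq = embed-or-outside-old c v
... | inj₂ v with refl ← splitAt⁻¹-↑ʳ eq = embed-or-outside-clone c v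

profile-cloneAt-embed : ∀ c (T : Triple k) v → profile (map3 (cloneAt c) T) (embed c v) ≡ profile T v
profile-cloneAt-embed c (a , b , d) v =
  cong₂ _,_ (lookup-cloneAt-embed c a v)
    (cong₂ _,_ (lookup-cloneAt-embed c b v) (lookup-cloneAt-embed c d v))

profile-cloneAt : ∀ c (T : Triple k) w →
  (∃ λ v → profile (map3 (cloneAt c) T) w ≡ profile T v) ⊎ profile (map3 (cloneAt c) T) w ≡ outside
profile-cloneAt c (a , b , d) w with embed-or-outside c w
... | inj₁ (v , refl) = inj₁ (v , profile-cloneAt-embed c (a , b , d) v)
... | inj₂ w∉        = inj₂ (cong₂ _,_ (w∉ a) (cong₂ _,_ (w∉ b) (w∉ d)))

union-cloneAt-embed : ∀ c (T : Triple k) v → lookup (union (map3 (cloneAt c) T)) (embed c v) ≡ lookup (union T) v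
union-cloneAt-embed c T v = begin
  lookup (union (map3 (cloneAt c) T)) (embed c v)  ≡⟨ lookup-union (map3 (cloneAt c) T) (embed c v) ⟩
  anyOf (profile (map3 (cloneAt c) T) (embed c v)) ≡⟨ cong anyOf (profile-cloneAt-embed c T v) ⟩
  anyOf (profile T v)                              ≡⟨ sym (lookup-union T v) ⟩
  lookup (union T) v                               ∎
  where open ≡-Reasoning

union-cloneAt-clone : ∀ c (T : Triple k) y → c ≢ just y →
  lookup (union (map3 (cloneAt c) T)) (k ↑ʳ y) ≡ false
union-cloneAt-clone {k} c (a , b , d) y c≢y
  rewrite lookup-union (map3 (cloneAt c) (a , b , d)) (k ↑ʳ y)
        | lookup-cloneAt-clone c a y c≢y | lookup-cloneAt-clone c b y c≢y
        | lookup-cloneAt-clone c d y c≢y = refl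

union-cloneAt-self : ∀ (T : Triple k) x →
  lookup (union (map3 (cloneAt (just x)) T)) (k ↑ʳ x) ≡ lookup (union T) x
union-cloneAt-self T x =
  trans (cong (lookup (union (map3 (cloneAt (just x)) T))) (sym (embed-self x)))
        (union-cloneAt-embed (just x) T x)

cloneAt-chosen : ∀ (T : Triple k) {x} c′ → lookup (union T) x ≡ true →
  union (map3 (cloneAt (just x)) T) ≡ union (map3 (cloneAt c′) T) → just x ≡ c′
cloneAt-chosen {k} T {x} c′ x∈T eq with ≡-dec _≟_ c′ (just x)
... | yes c′≡x = sym c′≡x
... | no  c′≢x = ⊥-elim (false≢true (begin
  false                                               ≡⟨ sym (union-cloneAt-clone c′ T x c′≢x) ⟩
  lookup (union (map3 (cloneAt c′) T)) (k ↑ʳ x)       ≡⟨ cong (λ U → lookup U (k ↑ʳ x)) (sym eq) ⟩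
  lookup (union (map3 (cloneAt (just x)) T)) (k ↑ʳ x) ≡⟨ union-cloneAt-self T x ⟩
  lookup (union T) x                                  ≡⟨ x∈T ⟩
  true                                                ∎))
  where open ≡-Reasoning

cloneAt-choice-injective : ∀ (T : Triple k) {c c′} →
  (∀ {x} → c ≡ just x → lookup (union T) x ≡ true) →
  (∀ {x} → c′ ≡ just x → lookup (union T) x ≡ true) →
  union (map3 (cloneAt c) T) ≡ union (map3 (cloneAt c′) T) → c ≡ c′
cloneAt-choice-injective T {nothing} {nothing} _     _      _  = refl
cloneAt-choice-injective T {just x}  {c′}      valid _      eq = cloneAt-chosen T c′ (valid refl) eq
cloneAt-choice-injective T {nothing} {just x′} _     valid′ eq =
  sym (cloneAt-chosen T nothing (valid′ refl) (sym eq))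

MotifOfType-cloneAt : ∀ {H i} c {T : Triple (n H)} →
  MotifOfType H i T → MotifOfType (ILTH H) i (map3 (cloneAt c) T)
MotifOfType-cloneAt {i = i} c {T} ((ea , eb , ed , a≢b , b≢d , a≢d) , (σ , hs)) =
  ( cloneAt-edge c ea , cloneAt-edge c eb , cloneAt-edge c ed
  , a≢b ∘ cloneAt-injective c c , b≢d ∘ cloneAt-injective c c , a≢d ∘ cloneAt-injective c c)
  , σ , subst (HasString (pattern-of i)) (sym (reorder-map3 σ (cloneAt c) T))
          (HasString-transport T′ (map3 (cloneAt c) T′)
            (λ v → embed c v , profile-cloneAt-embed c T′ v) (profile-cloneAt c T′) {pattern-of i} hs)
  where
  T′ = reorder σ T

SameMotif-cloneAt : ∀ {c c′} {T T′ : Triple k} →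
  SameMotif (map3 (cloneAt c) T) (map3 (cloneAt c′) T′) → SameMotif T T′
SameMotif-cloneAt {c = c} {c′} {T} (σ , eq) =
  σ , map3-cloneAt-injective c′ c (trans eq (reorder-map3 σ (cloneAt c) T))

choice : (Fin m → Fin k) → Fin (suc m) → Maybe (Fin k)
choice g zero    = nothing
choice g (suc l) = just (g l)

choice-injective : ∀ {g : Fin m → Fin k} → Injective _≡_ _≡_ g → Injective _≡_ _≡_ (choice g)
choice-injective g-inj {zero}  {zero}   _  = refl
choice-injective g-inj {suc l} {suc l′} eq = cong suc (g-inj (just-injective eq))

choice-covered : ∀ (U : Subset k) {g : Fin m → Fin k} → (∀ l → lookup U (g l) ≡ true) →
  ∀ c {x} → choice g c ≡ just x → lookup U x ≡ true
choice-covered U g∈U (suc l) refl = g∈U l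

record MarkedMotifs (m N : ℕ) (i : MotifType) (H : Hypergraph) : Set where
  field
    motif          : Fin N → Triple (n H)
    motif-isType   : ∀ j → MotifOfType H i (motif j)
    motif-distinct : ∀ j j′ → SameMotif (motif j) (motif j′) → j ≡ j′
    mark           : Fin N → Fin m → Fin (n H)
    mark-covered   : ∀ j l → lookup (union (motif j)) (mark j l) ≡ true
    mark-injective : ∀ j → Injective _≡_ _≡_ (mark j)

MarkedMotifs-single : ∀ {H i} (T : Triple (n H)) → MotifOfType H i T → MarkedMotifs ∣ union T ∣ 1 i H
MarkedMotifs-single T T-isType = record
  { motif          = λ _ → T
  ; motif-isType   = λ _ → T-isType
  ; motif-distinct = λ { zero zero _ → refl }
  ; mark           = λ _ → proj₁ (enumerate (union T))
  ; mark-covered   = λ _ → proj₁ (proj₂ (enumerate (union T)))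
  ; mark-injective = λ _ → proj₂ (proj₂ (enumerate (union T)))
  }

MarkedMotifs-ILTH : ∀ {N i H} → MarkedMotifs m N i H → MarkedMotifs m (suc m * N) i (ILTH H)
MarkedMotifs-ILTH {m} {N} {i} {H} M = record
  { motif          = cloned ∘ remQuot N
  ; motif-isType   = cloned-isType ∘ remQuot N
  ; motif-distinct = λ idx idx′ same → remQuot-injective N (cloned-distinct _ _ same)
  ; mark           = clonedMark ∘ remQuot N
  ; mark-covered   = clonedMark-covered ∘ remQuot N
  ; mark-injective = clonedMark-injective ∘ remQuot N
  }
  where
  open MarkedMotifs M
  Index : Set
  Index = Fin (suc m) × Fin N
  at : Index → Maybe (Fin (n H))
  at (c , j) = choice (mark j) c
  at-covered : ∀ ((c , j) : Index) {x} → at (c , j) ≡ just x → lookup (union (motif j)) x ≡ true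
  at-covered (c , j) = choice-covered (union (motif j)) (mark-covered j) c
  cloned : Index → Triple (n H + n H)
  cloned (c , j) = map3 (cloneAt (at (c , j))) (motif j)
  cloned-isType : ∀ p → MotifOfType (ILTH H) i (cloned p)
  cloned-isType (c , j) = MotifOfType-cloneAt {i = i} (at (c , j)) (motif-isType j)
  cloned-distinct : ∀ p p′ → SameMotif (cloned p) (cloned p′) → p ≡ p′
  cloned-distinct (c , j) (c′ , j′) same
    with motif-distinct j j′ (SameMotif-cloneAt {c = at (c , j)} {at (c′ , j′)} same)
  ... | refl = cong (_, j) (choice-injective (mark-injective j)
                 (cloneAt-choice-injective (motif j) (at-covered (c , j)) (at-covered (c′ , j))
                   (SameMotif⇒union≡ same)))
  clonedMark : Index → Fin m → Fin (n H + n H)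
  clonedMark (c , j) l = embed (at (c , j)) (mark j l)
  clonedMark-covered : ∀ p l → lookup (union (cloned p)) (clonedMark p l) ≡ true
  clonedMark-covered (c , j) l =
    trans (union-cloneAt-embed (at (c , j)) (motif j) (mark j l)) (mark-covered j l)
  clonedMark-injective : ∀ p → Injective _≡_ _≡_ (clonedMark p)
  clonedMark-injective (c , j) = mark-injective j ∘ embed-injective (at (c , j))

MarkedMotifs-ILTH^ : ∀ {i H} → MarkedMotifs m 1 i H → ∀ t → MarkedMotifs m (suc m ^ t) i (ILTH^ t H)
MarkedMotifs-ILTH^ M 0       = M
MarkedMotifs-ILTH^ M (suc t) = MarkedMotifs-ILTH (MarkedMotifs-ILTH^ M t)

theorem7 : (k : ℕ) → 2 ≤ k → (H₀ : Hypergraph) → Uniform k H₀ →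
           (i : MotifType) → (t₀ : Triple (n H₀)) → MotifOfType H₀ i t₀ →
           (t : ℕ) → AtLeastMotifs ((verticesOf t₀ + 1) ^ t) i (ILTH^ t H₀)
theorem7 _ _ H₀ _ i t₀ t₀-isType t =
  subst (λ b → AtLeastMotifs (b ^ t) i (ILTH^ t H₀)) (+-comm 1 (verticesOf t₀))
    (motif , motif-isType , motif-distinct)
  where open MarkedMotifs (MarkedMotifs-ILTH^ (MarkedMotifs-single {H₀} {i} t₀ t₀-isType) t)
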